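{- Let $\mathcal{G}$ be a finite simple graph with vertex set $\mathcal{V}$. Every $\mathcal{I}$-essential set $\mathcal{S}$ of $\mathcal{G}$ is the union of two orbits of $\mathcal{G}$.
   Context: $\mathcal{O}(x)$ denotes the orbit of $x$ under $\mathrm{Aut}(\mathcal{G})$. For $\mathcal{A}\subseteq\mathcal{V}$, $x\equiv_{\mathcal{A}}y$ iff $\mathcal{O}(x)\cap\mathcal{A}=\mathcal{O}(y)\cap\mathcal{A}$, and $\gamma_{\mathcal{A}}(\mathcal{G})$ is the partition of $\mathcal{V}$ into the equivalence classes of $\equiv_{\mathcal{A}}$. The information table $\mathcal{I}$ of $\mathcal{G}$ has attribute set $\mathcal{V}$. A subset $\mathcal{S}\subseteq\mathcal{V}$ is $\mathcal{I}$-essential if $\gamma_{\mathcal{V}\setminus\mathcal{S}}(\mathcal{G})\neq\gamma_{\mathcal{V}}(\mathcal{G})$ and for every proper subset $\mathcal{Q}\subsetneq\mathcal{S}$ one has $\gamma_{\mathcal{V}\setminus\mathcal{Q}}(\mathcal{G})=\gamma_{\mathcal{V}}(\mathcal{G})$. -}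

module Defs where

open import Data.Nat using (ℕ)
open import Data.Bool using (Bool; true; false)
open import Data.Fin using (Fin)
open import Data.Fin.Subset using (Subset; _∈_; _⊂_; ∁; ⊤)
open import Data.Fin.Permutation using (Permutation′; _⟨$⟩ʳ_)
open import Data.Product using (Σ; ∃; _×_)
open import Relation.Binary.PropositionalEquality using (_≡_)
open import Relation.Nullary using (¬_)
open import Function.Bundles using (_⇔_)

record SimpleGraph (n : ℕ) : Set where
  field
    adj   : Fin n → Fin n → Bool
    sym   : ∀ x y → adj x y ≡ adj y x
    irrefl : ∀ x → adj x x ≡ false
open SimpleGraph public

IsAut : ∀ {n} → SimpleGraph n → Permutation′ n → Set
IsAut G σ = ∀ x y → adj G (σ ⟨$⟩ʳ x) (σ ⟨$⟩ʳ y) ≡ adj G x y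

Aut : ∀ {n} → SimpleGraph n → Set
Aut {n} G = Σ (Permutation′ n) (IsAut G)

InOrbit : ∀ {n} → SimpleGraph n → Fin n → Fin n → Set
InOrbit G x z = ∃ λ (σ : Aut G) → Σ.proj₁ σ ⟨$⟩ʳ x ≡ z

EquivA : ∀ {n} → SimpleGraph n → Subset n → Fin n → Fin n → Set
EquivA G A x y = ∀ z → z ∈ A → (InOrbit G x z ⇔ InOrbit G y z)

-- γ_A(G) = γ_V(G): the partitions into ≡-classes coincide,
-- i.e. the two equivalence relations coincide.
SamePartitionAsV : ∀ {n} → SimpleGraph n → Subset n → Set
SamePartitionAsV G A = ∀ x y → EquivA G A x y ⇔ EquivA G ⊤ x y

IEssential : ∀ {n} → SimpleGraph n → Subset n → Set
IEssential {n} G S =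
  ¬ SamePartitionAsV G (∁ S) × (∀ (Q : Subset n) → Q ⊂ S → SamePartitionAsV G (∁ Q))

{-# OPTIONS --safe #-}
-- Since S is not redundant, some x and y in different orbits are not separated by ∁ S.
-- Both orbits lie inside S, for a point of either orbit outside S would lie in the other
-- orbit too.  Were S larger than 𝒪(x) ∪ 𝒪(y), this union would be a proper subset whose
-- complement still fails to separate x and y, contradicting minimality.  The argument is
-- constructive because orbit membership is decidable: there are only finitely many
-- candidate automorphisms.
module Submission where

open import Defs hiding (sym)
open import Data.Nat using (ℕ)
open import Data.Bool.Properties using (T-≡) renaming (_≟_ to _≟ᵇ_)
open import Data.Fin using (Fin; finToFun; funToFin)
open import Data.Fin.Properties using (any?; all?; finToFun-funToFin; _≟_)
open import Data.Fin.Subset using (Subset; _∈_; _⊂_; ∁)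
open import Data.Fin.Subset.Properties using (_∈?_; ∈⊤; x∈∁p⇒x∉p; x∉p⇒x∈∁p)
open import Data.Fin.Permutation
  using (permutation; flip; _∘ₚ_; inverseˡ; inverseʳ; _⟨$⟩ʳ_; _⟨$⟩ˡ_) renaming (id to idₚ)
open import Data.Vec using (tabulate)
open import Data.Vec.Properties using (lookup∘tabulate; []=⇒lookup; lookup⇒[]=)
open import Data.Product using (∃; ∃₂; _×_; _,_)
open import Data.Sum using (_⊎_; inj₁; inj₂; [_,_])
open import Function using (_∘_; _⇔_; mk⇔; Equivalence)
open import Function.Definitions using (StrictlyInverseˡ; StrictlyInverseʳ)
open import Function.Properties.Equivalence using () renaming (sym to ⇔-sym)
open import Level using (Level)
open import Relation.Binary.PropositionalEquality using (_≡_; _≗_; refl; sym; trans; cong; cong₂)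
open import Relation.Nullary using (Dec; yes; no; ¬_; ⌊_⌋; contradiction)
open import Relation.Nullary.Decidable using (map; map′; _×-dec_; _⊎-dec_; _→-dec_; ¬?; toWitness; fromWitness; decidable-stable)
open import Relation.Unary using (Pred; Decidable)

private
  variable
    a b p : Level
    m n : ℕ

-- A function is recovered from its code only up to ≗, hence the extensionality of P.
∃-fun? : {P : Pred (Fin m → Fin n) p} →
         (∀ {f g} → f ≗ g → P f → P g) → Decidable P → Dec (∃ P)
∃-fun? P-resp P? =
  map′ (λ (k , Pk) → finToFun k , Pk)
       (λ (f , Pf) → funToFin f , P-resp (sym ∘ finToFun-funToFin f) Pf)
       (any? (P? ∘ finToFun))

toSubset : {P : Pred (Fin n) p} → Decidable P → Subset n
toSubset P? = tabulate (⌊_⌋ ∘ P?)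

∈-toSubset : {P : Pred (Fin n) p} (P? : Decidable P) {x : Fin n} → x ∈ toSubset P? ⇔ P x
∈-toSubset P? {x} = mk⇔
  (λ x∈ → toWitness (Equivalence.from T-≡ (trans (sym (lookup∘tabulate _ x)) ([]=⇒lookup x∈))))
  (λ Px → lookup⇒[]= x _ (trans (lookup∘tabulate _ x) (Equivalence.to T-≡ (fromWitness Px))))

_⇔-dec_ : {A : Set a} {B : Set b} → Dec A → Dec B → Dec (A ⇔ B)
a? ⇔-dec b? = map′ (λ (f , g) → mk⇔ f g) (λ e → Equivalence.to e , Equivalence.from e)
                   ((a? →-dec b?) ×-dec (b? →-dec a?))

module _ (G : SimpleGraph n) where

  Aut-id : Aut G
  Aut-id = idₚ , λ _ _ → refl

  Aut-flip : Aut G → Aut G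
  Aut-flip (σ , σ-aut) = flip σ , λ x y →
    trans (sym (σ-aut _ _)) (cong₂ (adj G) (inverseʳ σ) (inverseʳ σ))

  Aut-∘ : Aut G → Aut G → Aut G
  Aut-∘ (σ , σ-aut) (τ , τ-aut) = σ ∘ₚ τ , λ x y → trans (τ-aut _ _) (σ-aut x y)

  InOrbit-refl : ∀ x → InOrbit G x x
  InOrbit-refl x = Aut-id , refl

  InOrbit-sym : ∀ {x y} → InOrbit G x y → InOrbit G y x
  InOrbit-sym (σ@(π , _) , πx≡y) = Aut-flip σ , trans (cong (π ⟨$⟩ˡ_) (sym πx≡y)) (inverseˡ π)

  InOrbit-trans : ∀ {x y z} → InOrbit G x y → InOrbit G y z → InOrbit G x z
  InOrbit-trans (σ , σx≡y) (τ@(π , _) , πy≡z) = Aut-∘ σ τ , trans (cong (π ⟨$⟩ʳ_) σx≡y) πy≡z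

  IsAutPair : (Fin n → Fin n) → (Fin n → Fin n) → Set
  IsAutPair f g = StrictlyInverseˡ _≡_ f g × StrictlyInverseʳ _≡_ f g ×
                  (∀ i j → adj G (f i) (f j) ≡ adj G i j)

  -- An automorphism as a pair of plain functions, so that it can be found by ∃-fun?.
  OrbitWitness : Fin n → Fin n → (Fin n → Fin n) → (Fin n → Fin n) → Set
  OrbitWitness x z f g = IsAutPair f g × f x ≡ z

  OrbitWitness-resp : ∀ {x z f f′ g g′} → f ≗ f′ → g ≗ g′ →
                      OrbitWitness x z f g → OrbitWitness x z f′ g′
  OrbitWitness-resp {x} f≗f′ g≗g′ ((fg≗id , gf≗id , f-adj) , fx≡z) =
    ( (λ i → trans (sym (∘-resp f≗f′ g≗g′ i)) (fg≗id i))
    , (λ i → trans (sym (∘-resp g≗g′ f≗f′ i)) (gf≗id i))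
    , (λ i j → trans (sym (cong₂ (adj G) (f≗f′ i) (f≗f′ j))) (f-adj i j)) )
    , trans (sym (f≗f′ x)) fx≡z
    where
    ∘-resp : ∀ {h h′ k k′ : Fin n → Fin n} → h ≗ h′ → k ≗ k′ → h ∘ k ≗ h′ ∘ k′
    ∘-resp {h} h≗h′ k≗k′ i = trans (cong h (k≗k′ i)) (h≗h′ _)

  OrbitWitness? : ∀ x z f g → Dec (OrbitWitness x z f g)
  OrbitWitness? x z f g =
    (all? (λ i → f (g i) ≟ i) ×-dec all? (λ i → g (f i) ≟ i) ×-dec
     all? (λ i → all? λ j → adj G (f i) (f j) ≟ᵇ adj G i j))
    ×-dec (f x ≟ z)

  ∃OrbitWitness⇔InOrbit : ∀ {x z} → ∃₂ (OrbitWitness x z) ⇔ InOrbit G x z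
  ∃OrbitWitness⇔InOrbit = mk⇔
    (λ (f , g , (fg≗id , gf≗id , f-adj) , fx≡z) → (permutation f g fg≗id gf≗id , f-adj) , fx≡z)
    (λ ((σ , σ-aut) , σx≡z) →
      (σ ⟨$⟩ʳ_) , (σ ⟨$⟩ˡ_) , ((λ _ → inverseʳ σ) , (λ _ → inverseˡ σ) , σ-aut) , σx≡z)

  InOrbit? : ∀ x z → Dec (InOrbit G x z)
  InOrbit? x z = map ∃OrbitWitness⇔InOrbit
    (∃-fun? (λ f≗f′ (g , w) → g , OrbitWitness-resp f≗f′ (λ _ → refl) w) λ f →
     ∃-fun? (OrbitWitness-resp (λ _ → refl)) (OrbitWitness? x z f))

  InOrbit⇒EquivA : ∀ {A x y} → InOrbit G x y → EquivA G A x y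
  InOrbit⇒EquivA x∼y _ _ = mk⇔ (InOrbit-trans (InOrbit-sym x∼y)) (InOrbit-trans x∼y)

  EquivA⇒InOrbit : ∀ {A x y} → y ∈ A → EquivA G A x y → InOrbit G x y
  EquivA⇒InOrbit {y = y} y∈A x≈y = Equivalence.from (x≈y y y∈A) (InOrbit-refl y)

  EquivA-sym : ∀ {A x y} → EquivA G A x y → EquivA G A y x
  EquivA-sym x≈y z z∈A = ⇔-sym (x≈y z z∈A)

  EquivA? : ∀ A x y → Dec (EquivA G A x y)
  EquivA? A x y = all? λ z → (z ∈? A) →-dec (InOrbit? x z ⇔-dec InOrbit? y z)

  separatedPair : ∀ {A} → ¬ SamePartitionAsV G A →
                  ∃₂ λ x y → EquivA G A x y × ¬ InOrbit G x y
  separatedPair {A} ¬same with any? (λ x → any? λ y → EquivA? A x y ×-dec ¬? (InOrbit? x y))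
  ... | yes separated = separated
  ... | no ¬separated = contradiction same ¬same
    where
    same : SamePartitionAsV G A
    same x y = mk⇔
      (λ x≈y → InOrbit⇒EquivA (decidable-stable (InOrbit? x y) λ x≁y → ¬separated (x , y , x≈y , x≁y)))
      (λ x≈y z _ → x≈y z ∈⊤)

  EquivA-∁ : ∀ {Q x y} → (∀ z → InOrbit G x z ⊎ InOrbit G y z → z ∈ Q) → EquivA G (∁ Q) x y
  EquivA-∁ orbits⊆Q z z∈∁Q =
    mk⇔ (λ x∼z → contradiction (orbits⊆Q z (inj₁ x∼z)) (x∈∁p⇒x∉p z∈∁Q))
        (λ y∼z → contradiction (orbits⊆Q z (inj₂ y∼z)) (x∈∁p⇒x∉p z∈∁Q))

  separated⇒orbit⊆ : ∀ {S x y} → EquivA G (∁ S) x y → ¬ InOrbit G x y →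
                     ∀ z → InOrbit G x z → z ∈ S
  separated⇒orbit⊆ {S} x≈y x≁y z x∼z = decidable-stable (z ∈? S) λ z∉S →
    x≁y (InOrbit-trans x∼z (InOrbit-sym (Equivalence.to (x≈y z (x∉p⇒x∈∁p z∉S)) x∼z)))

  separated⇒orbits⊆ : ∀ {S x y} → EquivA G (∁ S) x y → ¬ InOrbit G x y →
                      ∀ z → InOrbit G x z ⊎ InOrbit G y z → z ∈ S
  separated⇒orbits⊆ x≈y x≁y z =
    [ separated⇒orbit⊆ x≈y x≁y z , separated⇒orbit⊆ (EquivA-sym x≈y) (x≁y ∘ InOrbit-sym) z ]

  minimal⇒orbits-cover : ∀ {S x y} → (∀ Q → Q ⊂ S → SamePartitionAsV G (∁ Q)) → ¬ InOrbit G x y →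
                         (∀ z → InOrbit G x z ⊎ InOrbit G y z → z ∈ S) →
                         ∀ z → z ∈ S → InOrbit G x z ⊎ InOrbit G y z
  minimal⇒orbits-cover {S} {x} {y} minimal x≁y orbits⊆S z z∈S =
    decidable-stable (inOrbits? z) λ z∉orbits →
      x≁y (EquivA⇒InOrbit ∈⊤ (Equivalence.to (minimal Q (Q⊂S z∉orbits) x y) (EquivA-∁ Q⊇orbits)))
    where
    inOrbits? : ∀ w → Dec (InOrbit G x w ⊎ InOrbit G y w)
    inOrbits? w = InOrbit? x w ⊎-dec InOrbit? y w

    Q : Subset n
    Q = toSubset inOrbits?

    Q⊇orbits : ∀ w → InOrbit G x w ⊎ InOrbit G y w → w ∈ Q
    Q⊇orbits w = Equivalence.from (∈-toSubset inOrbits?)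

    Q⊂S : ¬ (InOrbit G x z ⊎ InOrbit G y z) → Q ⊂ S
    Q⊂S z∉orbits = (λ {w} w∈Q → orbits⊆S w (Equivalence.to (∈-toSubset inOrbits?) w∈Q))
                 , z , z∈S , z∉orbits ∘ Equivalence.to (∈-toSubset inOrbits?)

proposition3p1p3 : ∀ {n : ℕ} (G : SimpleGraph n) (S : Subset n) → IEssential G S →
    ∃₂ λ (x y : Fin n) → ¬ InOrbit G x y × (∀ z → (z ∈ S ⇔ (InOrbit G x z ⊎ InOrbit G y z)))
proposition3p1p3 G S (¬same , minimal) =
  let (x , y , x≈y , x≁y) = separatedPair G ¬same
      orbits⊆S = separated⇒orbits⊆ G x≈y x≁y
  in x , y , x≁y , λ z → mk⇔ (minimal⇒orbits-cover G minimal x≁y orbits⊆S z) (orbits⊆S z)
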